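{- For every positive integer $n$ and every $1\le i\le n$, the statistic $\sigma\mapsto\#\{j>i:\sigma_j<\sigma_i\}$ (the number of inversions starting at the $i$-th entry) on $S_n$ is $\frac{n-i}{2}$-mesic with respect to the Lehmer code rotation.
   Context: A statistic $f$ is $c$-mesic with respect to a bijection $\mathcal{X}$ of a finite set if its average over every orbit of $\mathcal{X}$ equals $c$. Lehmer code: $L(\sigma)_i=\#\{j>i:\sigma_j<\sigma_i\}\in\{0,\dots,n-i\}$, a bijection from $S_n$ to such tuples. The Lehmer code rotation sends $\sigma$ to the unique $\tau$ with $L(\tau)_i\equiv L(\sigma)_i+1\pmod{n-i+1}$ for all $i$. -}

module Defs where

open import Data.Nat using (ℕ; zero; suc; _+_; _*_; _∸_; _≤_; _<_)
open import Data.Nat.DivMod using (_%_)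
open import Data.Fin using (Fin; toℕ)
import Data.Fin as F
open import Data.Fin.Permutation using (Permutation′; _⟨$⟩ʳ_; _≈_)
open import Data.List using (List; filter; length; allFin; map; upTo)
open import Data.Nat.ListAction using (sum)
open import Data.Product using (_×_)
open import Relation.Nullary using (¬_; _×-dec_)
open import Relation.Binary.PropositionalEquality using (_≡_)

iter : {A : Set} → (A → A) → ℕ → A → A
iter X zero a = a
iter X (suc k) a = X (iter X k a)

lehmer : ∀ {n} → Permutation′ n → Fin n → ℕ
lehmer {n} σ i =
  length (filter (λ j → (i F.<? j) ×-dec ((σ ⟨$⟩ʳ j) F.<? (σ ⟨$⟩ʳ i))) (allFin n))

-- τ is the Lehmer code rotation of σ:
-- L(τ)_i ≡ L(σ)_i + 1 (mod n - i + 1), with 1-indexed i = toℕ i + 1,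
-- so the modulus n - i + 1 is suc (n ∸ suc (toℕ i)); both sides are normalized.
IsLehmerRotation : ∀ {n} → Permutation′ n → Permutation′ n → Set
IsLehmerRotation {n} σ τ =
  ∀ (i : Fin n) → lehmer τ i % suc (n ∸ suc (toℕ i)) ≡ suc (lehmer σ i) % suc (n ∸ suc (toℕ i))

invAt : ∀ {n} → Fin n → Permutation′ n → ℕ
invAt {n} i σ = length (filter (λ j → (i F.<? j) ×-dec ((σ ⟨$⟩ʳ j) F.<? (σ ⟨$⟩ʳ i))) (allFin n))

IsOrbitSize : ∀ {n} → (Permutation′ n → Permutation′ n) → Permutation′ n → ℕ → Set
IsOrbitSize X σ k = (1 ≤ k) × (iter X k σ ≈ σ) × (∀ t → 1 ≤ t → t < k → ¬ (iter X t σ ≈ σ))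

-- f is (num/den)-mesic w.r.t. X: over every orbit, average of f equals num/den,
-- i.e. den * (sum of f over the orbit) ≡ num * (orbit size).
Mesic : ∀ {n} → (Permutation′ n → Permutation′ n) → (Permutation′ n → ℕ) → ℕ → ℕ → Set
Mesic X f num den =
  ∀ σ k → IsOrbitSize X σ k → den * sum (map (λ t → f (iter X t σ)) (upTo k)) ≡ num * k

-- Along an orbit of the rotation, the i-th Lehmer entry is a counter modulo N = n - i + 1
-- (1-indexed i): it increases by one at each step and wraps around from N - 1 to 0.
-- Returning to the starting permutation forces the orbit length to be a multiple of N, so
-- the orbit sweeps every residue 0, …, N - 1 equally often, and their average is (N - 1)/2.
module Submission where

open import Defs
open import Data.Nat using (ℕ; zero; suc; _+_; _*_; _∸_; _≤_; _<_; z≤n; s≤s; s≤s⁻¹; NonZero)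
open import Data.Nat.Properties
open import Data.Nat.DivMod
open import Data.Nat.Divisibility using (_∣_; divides; m%n≡0⇒n∣m)
open import Data.Nat.Tactic.RingSolver using (solve-∀)
open import Data.Fin using (Fin; toℕ)
import Data.Fin as F
open import Data.Fin.Permutation using (Permutation′; _≈_)
open import Data.List using (filter; length; map; upTo; applyUpTo; tabulate; allFin)
open import Data.List.Properties using (length-filter; filter-reject; filter-≐; length-tabulate; map-upTo)
open import Data.Nat.ListAction using (sum)
open import Data.Product using (_,_; proj₁)
open import Level using (0ℓ)
open import Relation.Unary using (Pred; Decidable)
open import Relation.Binary.PropositionalEquality
open import Function using (id; _∘_)

length-filter-above≤ : ∀ {A : Set} {P : Pred A 0ℓ} (P? : Decidable P) {n} (i : Fin n) (g : Fin n → A) →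
                       (∀ j → P (g j) → i F.< j) → length (filter P? (tabulate g)) ≤ n ∸ suc (toℕ i)
length-filter-above≤ P? {suc n} F.zero g above =
  ≤-trans (≤-reflexive (cong length (filter-reject P? (n≮0 ∘ above F.zero))))
          (≤-trans (length-filter P? (tabulate (g ∘ F.suc))) (≤-reflexive (length-tabulate (g ∘ F.suc))))
length-filter-above≤ P? {suc n} (F.suc i) g above =
  ≤-trans (≤-reflexive (cong length (filter-reject P? (n≮0 ∘ above F.zero))))
          (length-filter-above≤ P? i (g ∘ F.suc) (λ j → s≤s⁻¹ ∘ above (F.suc j)))

lehmer< : ∀ {n} (σ : Permutation′ n) i → lehmer σ i < suc (n ∸ suc (toℕ i))
lehmer< σ i = s≤s (length-filter-above≤ _ i id (λ _ → proj₁))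

lehmer-resp-≈ : ∀ {n} (σ τ : Permutation′ n) → σ ≈ τ → ∀ i → lehmer σ i ≡ lehmer τ i
lehmer-resp-≈ {n} σ τ σ≈τ i = cong length (filter-≐ _ _
  ( (λ (i<j , σj<σi) → i<j , subst₂ F._<_ (σ≈τ _) (σ≈τ i) σj<σi)
  , (λ (i<j , τj<τi) → i<j , subst₂ F._<_ (sym (σ≈τ _)) (sym (σ≈τ i)) τj<τi))
  (allFin n))

lehmer-rotation : ∀ {n} (σ τ : Permutation′ n) → IsLehmerRotation σ τ →
                  ∀ i → lehmer τ i ≡ suc (lehmer σ i) % suc (n ∸ suc (toℕ i))
lehmer-rotation σ τ rot i = trans (sym (m<n⇒m%n≡m (lehmer< τ i))) (rot i)

[m+n%d]%d≡[m+n]%d : ∀ m n d .{{_ : NonZero d}} → (m + n % d) % d ≡ (m + n) % d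
[m+n%d]%d≡[m+n]%d m n d = begin
  (m + n % d) % d          ≡⟨ %-distribˡ-+ m (n % d) d ⟩
  (m % d + n % d % d) % d  ≡⟨ cong (λ x → (m % d + x) % d) (m%n%n≡m%n n d) ⟩
  (m % d + n % d) % d      ≡⟨ %-distribˡ-+ m n d ⟨
  (m + n) % d              ∎
  where open ≡-Reasoning

counter≡start+t%N : ∀ {N} .{{_ : NonZero N}} (a : ℕ → ℕ) → a 0 < N →
                    (∀ t → a (suc t) ≡ suc (a t) % N) → ∀ t → a t ≡ (a 0 + t) % N
counter≡start+t%N {N} a a₀<N step zero =
  trans (sym (m<n⇒m%n≡m a₀<N)) (cong (_% N) (sym (+-identityʳ (a 0))))
counter≡start+t%N {N} a a₀<N step (suc t) = begin
  a (suc t)                ≡⟨ step t ⟩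
  suc (a t) % N            ≡⟨ cong (λ x → suc x % N) (counter≡start+t%N a a₀<N step t) ⟩
  (1 + (a 0 + t) % N) % N  ≡⟨ [m+n%d]%d≡[m+n]%d 1 (a 0 + t) N ⟩
  suc (a 0 + t) % N        ≡⟨ cong (_% N) (+-suc (a 0) t) ⟨
  (a 0 + suc t) % N        ∎
  where open ≡-Reasoning

[c+k]%N≡c⇒N∣k : ∀ {c k N} .{{_ : NonZero N}} → c < N → (c + k) % N ≡ c → N ∣ k
[c+k]%N≡c⇒N∣k {c} {k} {N} c<N returns = m%n≡0⇒n∣m k N (begin
  k % N                      ≡⟨ [m+n]%n≡m%n k N ⟨
  (k + N) % N                ≡⟨ cong (_% N) (+-comm k N) ⟩
  (N + k) % N                ≡⟨ cong (λ x → (x + k) % N) (m∸n+n≡m (<⇒≤ c<N)) ⟨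
  (N ∸ c + c + k) % N        ≡⟨ cong (_% N) (+-assoc (N ∸ c) c k) ⟩
  (N ∸ c + (c + k)) % N      ≡⟨ [m+n%d]%d≡[m+n]%d (N ∸ c) (c + k) N ⟨
  (N ∸ c + (c + k) % N) % N  ≡⟨ cong (λ x → (N ∸ c + x) % N) returns ⟩
  (N ∸ c + c) % N            ≡⟨ cong (_% N) (m∸n+n≡m (<⇒≤ c<N)) ⟩
  N % N                      ≡⟨ n%n≡0 N ⟩
  0                          ∎)
  where open ≡-Reasoning

∑ : ℕ → (ℕ → ℕ) → ℕ
∑ zero    f = 0
∑ (suc k) f = f 0 + ∑ k (f ∘ suc)

sum-applyUpTo : ∀ (f : ℕ → ℕ) k → sum (applyUpTo f k) ≡ ∑ k f
sum-applyUpTo f zero    = refl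
sum-applyUpTo f (suc k) = cong (f 0 +_) (sum-applyUpTo (f ∘ suc) k)

sum-map-upTo : ∀ (f : ℕ → ℕ) k → sum (map f (upTo k)) ≡ ∑ k f
sum-map-upTo f k = trans (cong sum (map-upTo f k)) (sum-applyUpTo f k)

∑-cong : ∀ {f g : ℕ → ℕ} k → (∀ t → t < k → f t ≡ g t) → ∑ k f ≡ ∑ k g
∑-cong zero    f≡g = refl
∑-cong (suc k) f≡g = cong₂ _+_ (f≡g 0 (s≤s z≤n)) (∑-cong k (λ t t<k → f≡g (suc t) (s≤s t<k)))

∑-+ : ∀ (f : ℕ → ℕ) x y → ∑ (x + y) f ≡ ∑ x f + ∑ y (λ t → f (x + t))
∑-+ f zero    y = refl
∑-+ f (suc x) y = trans (cong (f 0 +_) (∑-+ (f ∘ suc) x y)) (sym (+-assoc (f 0) _ _))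

∑-suc : ∀ (f : ℕ → ℕ) k → ∑ (suc k) f ≡ ∑ k f + f k
∑-suc f k = begin
  ∑ (suc k) f                    ≡⟨ cong (λ x → ∑ x f) (+-comm 1 k) ⟩
  ∑ (k + 1) f                    ≡⟨ ∑-+ f k 1 ⟩
  ∑ k f + (f (k + 0) + 0)        ≡⟨ cong (λ x → ∑ k f + x) (+-identityʳ (f (k + 0))) ⟩
  ∑ k f + f (k + 0)              ≡⟨ cong (λ x → ∑ k f + f x) (+-identityʳ k) ⟩
  ∑ k f + f k                    ∎
  where open ≡-Reasoning

2*∑-id : ∀ m → 2 * ∑ (suc m) id ≡ suc m * m
2*∑-id zero    = refl
2*∑-id (suc m) = begin
  2 * ∑ (suc (suc m)) id        ≡⟨ cong (2 *_) (∑-suc id (suc m)) ⟩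
  2 * (∑ (suc m) id + suc m)    ≡⟨ *-distribˡ-+ 2 (∑ (suc m) id) (suc m) ⟩
  2 * ∑ (suc m) id + 2 * suc m  ≡⟨ cong (_+ 2 * suc m) (2*∑-id m) ⟩
  suc m * m + 2 * suc m         ≡⟨ arith m ⟩
  suc (suc m) * suc m           ∎
  where
  open ≡-Reasoning
  arith : ∀ m → suc m * m + 2 * suc m ≡ suc (suc m) * suc m
  arith = solve-∀

∑-%-shift : ∀ m c → ∑ (suc m) (λ t → (suc c + t) % suc m) ≡ ∑ (suc m) (λ t → (c + t) % suc m)
∑-%-shift m c = +-cancelʳ-≡ ((c + N) % N) _ _ (begin
  ∑ N (λ t → (suc c + t) % N) + (c + N) % N  ≡⟨ +-comm _ ((c + N) % N) ⟩
  (c + N) % N + ∑ N (λ t → (suc c + t) % N)  ≡⟨ cong₂ _+_ wrap (∑-cong N (λ t _ → cong (_% N) (+-suc c t))) ⟨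
  ∑ (suc N) (λ t → (c + t) % N)              ≡⟨ ∑-suc (λ t → (c + t) % N) N ⟩
  ∑ N (λ t → (c + t) % N) + (c + N) % N      ∎)
  where
  open ≡-Reasoning
  N = suc m
  wrap : (c + 0) % N ≡ (c + N) % N
  wrap = trans (cong (_% N) (+-identityʳ c)) (sym ([m+n]%n≡m%n c N))

2*∑-%-period : ∀ m c → 2 * ∑ (suc m) (λ t → (c + t) % suc m) ≡ suc m * m
2*∑-%-period m zero    = trans (cong (2 *_) (∑-cong (suc m) (λ t t<N → m<n⇒m%n≡m t<N))) (2*∑-id m)
2*∑-%-period m (suc c) = trans (cong (2 *_) (∑-%-shift m c)) (2*∑-%-period m c)

2*∑-%-periods : ∀ m c q → 2 * ∑ (q * suc m) (λ t → (c + t) % suc m) ≡ m * (q * suc m)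
2*∑-%-periods m c zero    = sym (*-zeroʳ m)
2*∑-%-periods m c (suc q) = begin
  2 * ∑ (N + q * N) f                                ≡⟨ cong (2 *_) (∑-+ f N (q * N)) ⟩
  2 * (∑ N f + ∑ (q * N) (λ t → f (N + t)))          ≡⟨ cong (λ x → 2 * (∑ N f + x)) (∑-cong (q * N) (λ t _ → f-periodic t)) ⟩
  2 * (∑ N f + ∑ (q * N) f)                          ≡⟨ *-distribˡ-+ 2 (∑ N f) (∑ (q * N) f) ⟩
  2 * ∑ N f + 2 * ∑ (q * N) f                        ≡⟨ cong₂ _+_ (2*∑-%-period m c) (2*∑-%-periods m c q) ⟩
  N * m + m * (q * N)                                ≡⟨ arith m (q * N) ⟩
  m * (N + q * N)                                    ∎
  where
  open ≡-Reasoning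
  N = suc m
  f : ℕ → ℕ
  f t = (c + t) % N
  f-periodic : ∀ t → f (N + t) ≡ f t
  f-periodic t = trans (cong (_% N) (trans (cong (c +_) (+-comm N t)) (sym (+-assoc c t N)))) ([m+n]%n≡m%n (c + t) N)
  arith : ∀ m x → suc m * m + m * x ≡ m * (suc m + x)
  arith = solve-∀

2*∑-%-multiple : ∀ m c {k} → suc m ∣ k → 2 * ∑ k (λ t → (c + t) % suc m) ≡ m * k
2*∑-%-multiple m c (divides q refl) = 2*∑-%-periods m c q

theorem4p14 : (n : ℕ) → 1 ≤ n → (X : Permutation′ n → Permutation′ n) → (∀ σ → IsLehmerRotation σ (X σ)) → (i : Fin n) → Mesic X (invAt i) (n ∸ suc (toℕ i)) 2
theorem4p14 n _ X rotation i σ k (_ , returns , _) = begin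
  2 * sum (map (λ t → invAt i (iter X t σ)) (upTo k))  ≡⟨ cong (2 *_) (sum-map-upTo (λ t → invAt i (iter X t σ)) k) ⟩
  2 * ∑ k a                                            ≡⟨ cong (2 *_) (∑-cong k (λ t _ → counter t)) ⟩
  2 * ∑ k (λ t → (a 0 + t) % N)                        ≡⟨ 2*∑-%-multiple m (a 0) N∣k ⟩
  m * k                                                ∎
  where
  open ≡-Reasoning
  m = n ∸ suc (toℕ i)
  N = suc m
  a : ℕ → ℕ
  a t = lehmer (iter X t σ) i
  counter : ∀ t → a t ≡ (a 0 + t) % N
  counter = counter≡start+t%N a (lehmer< σ i) (λ t → lehmer-rotation (iter X t σ) (X (iter X t σ)) (rotation (iter X t σ)) i)
  N∣k : N ∣ k
  N∣k = [c+k]%N≡c⇒N∣k (lehmer< σ i) (trans (sym (counter k)) (lehmer-resp-≈ (iter X k σ) σ returns i))
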